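{- Let $\pi\in\mathcal{S}_n$ and let $w_1\cdots w_{n-1}$ be a word over $\mathbb{N}$ with $w_j-w_i\ge z_j-z_i$ for all $1\le i,j<n$ with $\pi(j)>\pi(i)$. If $\pi(n)=1$ and $n-m$ is even, then $w_{[m,n)}0$ is primitive. If $\pi(n)\ne1$, then $w_{[\ell,n)}$ is almost primitive. If $\pi(n)\ne n$, then $w_{[r,n)}$ is almost primitive. In particular, if $\pi(n)\notin\{1,n\}$, then $\overline{z_{[\ell,n)}}=\overline{z_{[r,n)}}$ if and only if $\pi$ is collapsed.
   Context: $\mathbb{N}=\{0,1,2,\dots\}$; $w_{[i,j)}=w_i\cdots w_{j-1}$; $\overline v=vvv\cdots$. A finite word $v$ is primitive if $v=s^k$ implies $s=v$, $k=1$; it is almost primitive if $v=s^k$ implies $k=1$, or $k=2$ and $s$ has odd length. For $\pi\in\mathcal{S}_n$: $m=\pi^{ -1}(n)$; $\ell=\pi^{ -1}(\pi(n)-1)$ if $\pi(n)\ne1$; $r=\pi^{ -1}(\pi(n)+1)$ if $\pi(n)\ne n$; for $1\le j<n$, $z_j=\#\{1\le i<\pi(j):\ (i\ne\pi(n)\ne i+1$ and $\pi(\pi^{ -1}(i)+1)<\pi(\pi^{ -1}(i+1)+1))$ or $(i+1=\pi(n)\ne n$ and $\pi(\ell+1)<\pi(r+1))\}$. $\pi$ is collapsed if $\pi(n)\notin\{1,n\}$ and (as words) $z_{[\ell,n)}=z_{[r,n)}z_{[r,n)}$ or $z_{[r,n)}=z_{[\ell,n)}z_{[\ell,n)}$.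 -}

module Defs where

open import Data.Nat using (ℕ; zero; suc; _+_; _∸_; _≤_; _<_; _%_; _≡ᵇ_; _<ᵇ_)
open import Data.Bool using (Bool; true; false; _∧_; _∨_; not; if_then_else_)
open import Data.List using (List; []; _∷_; _++_; map; length; concat; replicate)
open import Data.Product using (_×_)
open import Data.Sum using (_⊎_)
open import Relation.Binary.PropositionalEquality using (_≡_)

-- A permutation π ∈ S_n of {1,…,n}, given (1-based) as a map on ℕ together with
-- its inverse; values outside {1,…,n} are irrelevant.
record Perm (n : ℕ) : Set where
  field
    fun       : ℕ → ℕ
    inv       : ℕ → ℕ
    fun-range : ∀ i → 1 ≤ i → i ≤ n → 1 ≤ fun i × fun i ≤ n
    inv-range : ∀ i → 1 ≤ i → i ≤ n → 1 ≤ inv i × inv i ≤ n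
    inv-fun   : ∀ i → 1 ≤ i → i ≤ n → inv (fun i) ≡ i
    fun-inv   : ∀ i → 1 ≤ i → i ≤ n → fun (inv i) ≡ i

open Perm public

-- the list [a, a+1, …, b-1]
range : ℕ → ℕ → List ℕ
range a zero = []
range a (suc k) = go a (suc k ∸ a)
  where
  go : ℕ → ℕ → List ℕ
  go x zero = []
  go x (suc c) = x ∷ go (suc x) c

slice : (ℕ → ℕ) → ℕ → ℕ → List ℕ
slice w i j = map w (range i j)

count : (ℕ → Bool) → ℕ → ℕ → ℕ
count p a b = length (Data.List.filterᵇ p (range a b))

mIdx : ∀ {n} → Perm n → ℕ
mIdx {n} π = inv π n

ℓIdx : ∀ {n} → Perm n → ℕ
ℓIdx {n} π = inv π (fun π n ∸ 1)

rIdx : ∀ {n} → Perm n → ℕ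
rIdx {n} π = inv π (suc (fun π n))

zCond : ∀ {n} → Perm n → ℕ → Bool
zCond {n} π i =
  (not (i ≡ᵇ p n) ∧ not (suc i ≡ᵇ p n) ∧ (p (suc (q i)) <ᵇ p (suc (q (suc i)))))
  ∨ ((suc i ≡ᵇ p n) ∧ not (p n ≡ᵇ n) ∧ (p (suc (ℓIdx π)) <ᵇ p (suc (rIdx π))))
  where
  p = fun π
  q = inv π

-- z_j = #{1 ≤ i < π(j) : zCond i}   (meaningful for 1 ≤ j < n)
z : ∀ {n} → Perm n → ℕ → ℕ
z π j = count (zCond π) 1 (fun π j)

pow : List ℕ → ℕ → List ℕ
pow s k = concat (replicate k s)

Primitive : List ℕ → Set
Primitive v = ∀ s k → v ≡ pow s k → s ≡ v × k ≡ 1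

AlmostPrimitive : List ℕ → Set
AlmostPrimitive v = ∀ s k → v ≡ pow s k → k ≡ 1 ⊎ (k ≡ 2 × length s % 2 ≡ 1)

-- letter at position i (0-based), default 0
at : List ℕ → ℕ → ℕ
at [] i = 0
at (x ∷ xs) zero = x
at (x ∷ xs) (suc i) = at xs i

-- the infinite word v̄ = vvv⋯ as a function ℕ → ℕ (position i, 0-based);
-- for nonempty v, position i of v^(i+1) is v_(i mod |v|)
omega : List ℕ → ℕ → ℕ
omega v i = at (pow v (suc i)) i

Collapsed : ∀ {n} → Perm n → Set
Collapsed {n} π =
  ¬≡ (fun π n) 1 × ¬≡ (fun π n) n ×
  (slice (z π) (ℓIdx π) n ≡ slice (z π) (rIdx π) n ++ slice (z π) (rIdx π) n
   ⊎ slice (z π) (rIdx π) n ≡ slice (z π) (ℓIdx π) n ++ slice (z π) (ℓIdx π) n)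
  where
  open import Relation.Nullary using (¬_)
  ¬≡ : ℕ → ℕ → Set
  ¬≡ a b = ¬ (a ≡ b)

module Submission where

-- Lemma 5.  The engine is one step (swap-step): if w_i = w_j and π(i) < π(j)
-- for positions i, j < n, then π(j+1) < π(i+1).  The slope condition forces
-- z_j ≤ z_i, so zCond fails on [π(i), π(j)), and by the definition of zCond
-- the π-value of the next position cannot increase along that range (descent;
-- the value π(n) is bridged by comparing π(ℓ+1), π(r+1)).  Iterated along two
-- windows with equal letters (transport), the order of π at the starts
-- reappears at the ends, reversed once per letter.  If w_[b,n) = sᵏ with π(b)
-- adjacent to π(n), transport between shifted copies of s either moves π
-- monotonically or constrains four values, contradicting adjacency unless
-- k = 1 or (k = 2, |s| odd): so w_[ℓ,n) and w_[r,n) are almost primitive.  For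
-- π(n) = 1 one odd transport pushes a value below 1.  Finally z satisfies the
-- slope condition itself, and almost primitive words of different lengths with
-- the same infinite power are a word and its square (a common period from
-- Bézout).  The file develops words, parity, windows, then the permutation
-- (Positions) and the slope condition (SlopeWord), and ends with the theorem.

open import Defs
open import Data.Nat using (ℕ; _+_; _∸_; _≤_; _<_; _%_)
open import Data.List using ([]; _∷_; _++_)
open import Data.Product using (_×_)
open import Function.Bundles using (_⇔_)
open import Relation.Nullary using (¬_)
open import Relation.Binary.PropositionalEquality using (_≡_)

open import Data.Nat
open import Data.Nat.Properties
open import Data.Nat.DivMod using (_/_; %-distribˡ-*; %-distribˡ-+; m≡m%n+[m/n]*n; [m+n]%n≡m%n; m<n⇒m%n≡m; m%n<n)
open import Data.Nat.GCD using (module Bézout; module GCD)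
open import Data.Nat.Divisibility using (divides; m%n≡0⇒n∣m)
open import Data.Bool using (Bool; true; false; T; not)
open import Data.Bool.Properties using (T-∨; T-∧)
open import Data.Empty using (⊥; ⊥-elim)
open import Data.List using (List; length; applyUpTo)
open import Data.List.Properties using (++-assoc; ++-identityʳ; length-++; length-map; length-applyUpTo)
open import Data.Product using (_,_; proj₁; proj₂)
open import Data.Sum using (_⊎_; inj₁; inj₂)
open import Data.Unit using (tt)
open import Function using (_∘_)
open import Function.Bundles using (Equivalence; mk⇔)
open import Relation.Binary.Definitions using (tri<; tri≈; tri>)
open import Relation.Binary.PropositionalEquality
open import Relation.Nullary using (Dec; yes; no; contradiction)

range-step : ∀ {a b} → a < b → range a b ≡ a ∷ range (suc a) b
range-step {a} {suc k} (s≤s a≤k) rewrite +-∸-assoc 1 a≤k = refl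

range-empty : ∀ {a b} → b ≤ a → range a b ≡ []
range-empty {a} {zero} _ = refl
range-empty {a} {suc k} b≤a rewrite m≤n⇒m∸n≡0 b≤a = refl

∸-step : ∀ a b {d} → b ∸ a ≡ suc d → b ∸ suc a ≡ d
∸-step a b e = trans (sym (pred[m∸n]≡m∸[1+n] b a)) (cong pred e)

∸-positive : ∀ a b {t} → t < b ∸ a → a < b
∸-positive a b {t} t<b∸a = ≰⇒> (λ b≤a → n≮0 (subst (t <_) (m≤n⇒m∸n≡0 b≤a) t<b∸a))

∸-shrink : ∀ a b {t} → suc t < b ∸ a → t < b ∸ suc a
∸-shrink a b {t} lt = subst (t <_) (pred[m∸n]≡m∸[1+n] b a) (<⇒≤pred lt)

length-range : ∀ d a b → b ∸ a ≡ d → length (range a b) ≡ d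
length-range zero a b e rewrite range-empty {a} {b} (m∸n≡0⇒m≤n e) = refl
length-range (suc d) a b e rewrite range-step {a} {b} (∸-positive a b (subst (0 <_) (sym e) z<s)) =
  cong suc (length-range d (suc a) b (∸-step a b e))

slice-length : ∀ w a b → length (slice w a b) ≡ b ∸ a
slice-length w a b = trans (length-map w (range a b)) (length-range (b ∸ a) a b refl)

slice-at : ∀ w a b t → t < b ∸ a → at (slice w a b) t ≡ w (a + t)
slice-at w a b zero lt rewrite range-step {a} {b} (∸-positive a b lt) | +-identityʳ a = refl
slice-at w a b (suc t) lt rewrite range-step {a} {b} (∸-positive a b lt) | +-suc a t =
  slice-at w (suc a) b t (∸-shrink a b lt)

indicator : Bool → ℕ
indicator true = 1
indicator false = 0

count-cons : ∀ p a b → a < b → count p a b ≡ indicator (p a) + count p (suc a) b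
count-cons p a b a<b rewrite range-step {a} {b} a<b with p a
... | true = refl
... | false = refl

count-empty : ∀ p a → count p a a ≡ 0
count-empty p a rewrite range-empty {a} {a} ≤-refl = refl

count-split′ : ∀ p a d b → a + d ≤ b → count p a b ≡ count p a (a + d) + count p (a + d) b
count-split′ p a zero b _ rewrite +-identityʳ a | count-empty p a = refl
count-split′ p a (suc d) b le = begin
  count p a b
    ≡⟨ count-cons p a b a<b ⟩
  indicator (p a) + count p (suc a) b
    ≡⟨ cong (indicator (p a) +_) (count-split′ p (suc a) d b le′) ⟩
  indicator (p a) + (count p (suc a) (suc a + d) + count p (suc a + d) b)
    ≡⟨ sym (+-assoc (indicator (p a)) _ _) ⟩
  (indicator (p a) + count p (suc a) (suc a + d)) + count p (suc a + d) b
    ≡⟨ cong (_+ count p (suc a + d) b) (sym (count-cons p a (suc a + d) (s≤s (m≤m+n a d)))) ⟩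
  count p a (suc a + d) + count p (suc a + d) b
    ≡⟨ cong (λ c → count p a c + count p c b) (sym (+-suc a d)) ⟩
  count p a (a + suc d) + count p (a + suc d) b
    ∎
  where
  open ≡-Reasoning
  le′ : suc a + d ≤ b
  le′ = subst (_≤ b) (+-suc a d) le
  a<b : a < b
  a<b = ≤-trans (s≤s (m≤m+n a d)) le′

count-split : ∀ p {a c b} → a ≤ c → c ≤ b → count p a b ≡ count p a c + count p c b
count-split p {a} {c} {b} a≤c c≤b =
  subst (λ x → count p a b ≡ count p a x + count p x b) (m+[n∸m]≡n a≤c)
        (count-split′ p a (c ∸ a) b (subst (_≤ b) (sym (m+[n∸m]≡n a≤c)) c≤b))

count-zero : ∀ p {a b c} → count p a b ≡ 0 → a ≤ c → c < b → p c ≡ false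
count-zero p {a} {b} {c} none a≤c c<b with p c in pc
... | false = refl
... | true = contradiction (m+n≡0⇒n≡0 (count p a c) (trans (sym total) none)) 1+n≢0
  where
  total : count p a b ≡ count p a c + suc (count p (suc c) b)
  total = trans (count-split p a≤c (<⇒≤ c<b))
                (cong (count p a c +_) (trans (count-cons p c b c<b) (cong (λ x → indicator x + count p (suc c) b) pc)))

at-++ˡ : ∀ xs ys {i} → i < length xs → at (xs ++ ys) i ≡ at xs i
at-++ˡ (x ∷ xs) ys {zero} _ = refl
at-++ˡ (x ∷ xs) ys {suc i} (s≤s lt) = at-++ˡ xs ys lt

at-++ʳ : ∀ xs ys i → at (xs ++ ys) (length xs + i) ≡ at ys i
at-++ʳ [] ys i = refl
at-++ʳ (x ∷ xs) ys i = at-++ʳ xs ys i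

at-applyUpTo : ∀ f n {i} → i < n → at (applyUpTo f n) i ≡ f i
at-applyUpTo f (suc n) {zero} _ = refl
at-applyUpTo f (suc n) {suc i} (s≤s lt) = at-applyUpTo (f ∘ suc) n lt

at-ext : ∀ xs ys → length xs ≡ length ys → (∀ i → i < length xs → at xs i ≡ at ys i) → xs ≡ ys
at-ext [] [] _ _ = refl
at-ext (x ∷ xs) (y ∷ ys) len eq =
  cong₂ _∷_ (eq 0 z<s) (at-ext xs ys (suc-injective len) (λ i lt → eq (suc i) (s<s lt)))

length-pow : ∀ s k → length (pow s k) ≡ k * length s
length-pow s zero = refl
length-pow s (suc k) = trans (length-++ s) (cong (length s +_) (length-pow s k))

pow-+ : ∀ s a b → pow s (a + b) ≡ pow s a ++ pow s b
pow-+ s zero b = refl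
pow-+ s (suc a) b = trans (cong (s ++_) (pow-+ s a b)) (sym (++-assoc s (pow s a) (pow s b)))

pow-* : ∀ s a b → pow (pow s a) b ≡ pow s (b * a)
pow-* s a zero = refl
pow-* s a (suc b) = trans (cong (pow s a ++_) (pow-* s a b)) (sym (pow-+ s a (b * a)))

at-pow : ∀ s k i .{{_ : NonZero (length s)}} → i < k * length s → at (pow s k) i ≡ at s (i % length s)
at-pow s (suc k) i lt with i <? length s
... | yes i<s = trans (at-++ˡ s (pow s k) i<s) (cong (at s) (sym (m<n⇒m%n≡m i<s)))
... | no i≮s = begin
  at (s ++ pow s k) i                      ≡⟨ cong (at (s ++ pow s k)) (sym i≡s+j) ⟩
  at (s ++ pow s k) (length s + j)         ≡⟨ at-++ʳ s (pow s k) j ⟩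
  at (pow s k) j                           ≡⟨ at-pow s k j j<ks ⟩
  at s (j % length s)                      ≡⟨ cong (at s) (sym ([m+n]%n≡m%n j (length s))) ⟩
  at s ((j + length s) % length s)         ≡⟨ cong (λ x → at s (x % length s)) (trans (+-comm j (length s)) i≡s+j) ⟩
  at s (i % length s)                      ∎
  where
  open ≡-Reasoning
  j : ℕ
  j = i ∸ length s
  i≡s+j : length s + j ≡ i
  i≡s+j = m+[n∸m]≡n (≮⇒≥ i≮s)
  j<ks : j < k * length s
  j<ks = +-cancelˡ-< (length s) j (k * length s) (subst (_< length s + k * length s) (sym i≡s+j) lt)

omega-at : ∀ v i .{{_ : NonZero (length v)}} → omega v i ≡ at v (i % length v)
omega-at v i = at-pow v (suc i) i (<-≤-trans (n<1+n i) (m≤m*n (suc i) (length v)))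

omega-prefix : ∀ v {i} → i < length v → omega v i ≡ at v i
omega-prefix v {i} lt = at-++ˡ v (pow v i) lt

omega-square : ∀ v i .{{_ : NonZero (length v)}} → omega (v ++ v) i ≡ omega v i
omega-square v i = begin
  at (pow (v ++ v) (suc i)) i          ≡⟨ cong (λ u → at (pow u (suc i)) i) (cong (v ++_) (sym (++-identityʳ v))) ⟩
  at (pow (pow v 2) (suc i)) i         ≡⟨ cong (λ u → at u i) (pow-* v 2 (suc i)) ⟩
  at (pow v (suc i * 2)) i             ≡⟨ at-pow v (suc i * 2) i i<2[i+1]|v| ⟩
  at v (i % length v)                  ≡⟨ sym (omega-at v i) ⟩
  omega v i                            ∎
  where
  open ≡-Reasoning
  i<2[i+1]|v| : i < suc i * 2 * length v
  i<2[i+1]|v| = <-≤-trans (n<1+n i) (≤-trans (m≤m*n (suc i) 2) (m≤m*n (suc i * 2) (length v)))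

Period : (ℕ → ℕ) → ℕ → Set
Period W p = ∀ i → W (i + p) ≡ W i

omega-period : ∀ v .{{_ : NonZero (length v)}} → Period (omega v) (length v)
omega-period v i = begin
  omega v (i + length v)               ≡⟨ omega-at v (i + length v) ⟩
  at v ((i + length v) % length v)     ≡⟨ cong (at v) ([m+n]%n≡m%n i (length v)) ⟩
  at v (i % length v)                  ≡⟨ sym (omega-at v i) ⟩
  omega v i                            ∎
  where open ≡-Reasoning

period-multiple : ∀ {W p} → Period W p → ∀ c i → W (i + c * p) ≡ W i
period-multiple {W} {p} per zero i = cong W (+-identityʳ i)
period-multiple {W} {p} per (suc c) i = begin
  W (i + (p + c * p))                  ≡⟨ cong W (trans (cong (i +_) (+-comm p (c * p))) (sym (+-assoc i (c * p) p))) ⟩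
  W (i + c * p + p)                    ≡⟨ per (i + c * p) ⟩
  W (i + c * p)                        ≡⟨ period-multiple per c i ⟩
  W i                                  ∎
  where open ≡-Reasoning

period-bezout : ∀ {W p q d} → Period W p → Period W q → Bézout.Identity d p q → Period W d
period-bezout {W} {p} {q} {d} per-p per-q (Bézout.+- x y eq) i = begin
  W (i + d)                            ≡⟨ sym (period-multiple per-q y (i + d)) ⟩
  W (i + d + y * q)                    ≡⟨ cong W (trans (+-assoc i d (y * q)) (cong (i +_) eq)) ⟩
  W (i + x * p)                        ≡⟨ period-multiple per-p x i ⟩
  W i                                  ∎
  where open ≡-Reasoning
period-bezout {W} {p} {q} {d} per-p per-q (Bézout.-+ x y eq) i = begin
  W (i + d)                            ≡⟨ sym (period-multiple per-p x (i + d)) ⟩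
  W (i + d + x * p)                    ≡⟨ cong W (trans (+-assoc i d (x * p)) (cong (i +_) eq)) ⟩
  W (i + y * q)                        ≡⟨ period-multiple per-q y i ⟩
  W i                                  ∎
  where open ≡-Reasoning

period-mod : ∀ {W g} .{{_ : NonZero g}} → Period W g → ∀ i → W (i % g) ≡ W i
period-mod {W} {g} per i = trans (sym (period-multiple per (i / g) (i % g))) (cong W (sym (m≡m%n+[m/n]*n i g)))

power-of-period : ∀ {W g} u c → Period W (suc g) → (∀ i → i < length u → at u i ≡ W i) →
                  length u ≡ c * suc g → u ≡ pow (applyUpTo W (suc g)) c
power-of-period {W} {g} u c per follows len = at-ext u (pow t c) len′ letters
  where
  t : List ℕ
  t = applyUpTo W (suc g)
  len-t : length t ≡ suc g
  len-t = length-applyUpTo W (suc g)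
  len′ : length u ≡ length (pow t c)
  len′ = trans len (trans (cong (c *_) (sym len-t)) (sym (length-pow t c)))
  letters : ∀ i → i < length u → at u i ≡ at (pow t c) i
  letters i lt = begin
    at u i                     ≡⟨ follows i lt ⟩
    W i                        ≡⟨ sym (period-mod per i) ⟩
    W (i % suc g)              ≡⟨ sym (at-applyUpTo W (suc g) (m%n<n i (suc g))) ⟩
    at t (i % suc g)           ≡⟨ cong (λ m → at t (i % suc m)) (sym (length-applyUpTo (W ∘ suc) g)) ⟩
    at t (i % length t)        ≡⟨ sym (at-pow t c i (subst (i <_) (trans len′ (length-pow t c)) lt)) ⟩
    at (pow t c) i             ∎
    where open ≡-Reasoning

-- Two almost primitive words of different lengths with the same infinite
-- power: both are powers of a common root of length gcd(|u|,|v|), with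
-- exponents in {1,2} and distinct, so one is the square of the other.
same-power⇒square : ∀ u v → AlmostPrimitive u → AlmostPrimitive v → 0 < length u → 0 < length v →
                    length u ≢ length v → (∀ i → omega u i ≡ omega v i) → u ≡ v ++ v ⊎ v ≡ u ++ u
same-power⇒square u v ap-u ap-v u>0 v>0 |u|≢|v| same
  with Bézout.lemma (length u) (length v)
... | Bézout.result d gcd identity
  with GCD.gcd∣m gcd | GCD.gcd∣n gcd
... | divides c |u|≡cd | divides c′ |v|≡c′d = squares d |u|≡cd |v|≡c′d period-d
  where
  W : ℕ → ℕ
  W = omega u
  period-u : Period W (length u)
  period-u = omega-period u {{>-nonZero u>0}}
  period-v : Period W (length v)
  period-v i = trans (same (i + length v)) (trans (omega-period v {{>-nonZero v>0}} i) (sym (same i)))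
  period-d : Period W d
  period-d = period-bezout period-u period-v identity
  squares : ∀ d → length u ≡ c * d → length v ≡ c′ * d → Period W d → u ≡ v ++ v ⊎ v ≡ u ++ u
  squares zero |u|≡0 _ _ = contradiction (trans |u|≡0 (*-zeroʳ c)) (>⇒≢ u>0)
  squares (suc g) |u|≡cd |v|≡c′d period = roots (ap-u t c u≡tᶜ) (ap-v t c′ v≡tᶜ′)
    where
    t : List ℕ
    t = applyUpTo W (suc g)
    u≡tᶜ : u ≡ pow t c
    u≡tᶜ = power-of-period u c period (λ i lt → sym (omega-prefix u lt)) |u|≡cd
    v≡tᶜ′ : v ≡ pow t c′
    v≡tᶜ′ = power-of-period v c′ period (λ i lt → trans (sym (omega-prefix v lt)) (sym (same i))) |v|≡c′d
    t²≡tt : pow t 2 ≡ pow t 1 ++ pow t 1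
    t²≡tt = pow-+ t 1 1
    roots : c ≡ 1 ⊎ (c ≡ 2 × length t % 2 ≡ 1) → c′ ≡ 1 ⊎ (c′ ≡ 2 × length t % 2 ≡ 1) →
            u ≡ v ++ v ⊎ v ≡ u ++ u
    roots (inj₁ refl) (inj₁ refl) = contradiction (trans |u|≡cd (sym |v|≡c′d)) |u|≢|v|
    roots (inj₁ refl) (inj₂ (refl , _)) = inj₂ (trans v≡tᶜ′ (trans t²≡tt (sym (cong₂ _++_ u≡tᶜ u≡tᶜ))))
    roots (inj₂ (refl , _)) (inj₁ refl) = inj₁ (trans u≡tᶜ (trans t²≡tt (sym (cong₂ _++_ v≡tᶜ′ v≡tᶜ′))))
    roots (inj₂ (refl , _)) (inj₂ (refl , _)) = contradiction (trans |u|≡cd (sym |v|≡c′d)) |u|≢|v|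

even-or-odd : ∀ d → d % 2 ≡ 0 ⊎ d % 2 ≡ 1
even-or-odd zero = inj₁ refl
even-or-odd (suc zero) = inj₂ refl
even-or-odd (suc (suc d)) = even-or-odd d

even-suc : ∀ d → d % 2 ≡ 0 → suc d % 2 ≡ 1
even-suc zero _ = refl
even-suc (suc (suc d)) e = even-suc d e

odd-suc : ∀ d → d % 2 ≡ 1 → suc d % 2 ≡ 0
odd-suc (suc zero) _ = refl
odd-suc (suc (suc d)) o = odd-suc d o

*-evenʳ : ∀ a b → b % 2 ≡ 0 → (a * b) % 2 ≡ 0
*-evenʳ a b e = trans (%-distribˡ-* a b 2) (trans (cong (λ x → (a % 2 * x) % 2) e) (cong (_% 2) (*-zeroʳ (a % 2))))

*-evenˡ : ∀ a b → a % 2 ≡ 0 → (a * b) % 2 ≡ 0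
*-evenˡ a b e = trans (cong (_% 2) (*-comm a b)) (*-evenʳ b a e)

+-even-odd : ∀ a b → a % 2 ≡ 0 → b % 2 ≡ 1 → (a + b) % 2 ≡ 1
+-even-odd a b ea eb = trans (%-distribˡ-+ a b 2) (cong₂ (λ x y → (x + y) % 2) ea eb)

odd⇒positive : ∀ {p} → p % 2 ≡ 1 → 1 ≤ p
odd⇒positive {suc _} _ = s≤s z≤n

odd-proper-factor : ∀ {L p} k′ → L % 2 ≡ 0 → suc L ≡ suc (suc k′) * p →
                    p % 2 ≡ 1 × p ≤ L × (L ∸ p) % 2 ≡ 1
odd-proper-factor {L} {p} k′ L-even 1+L≡kp = p-odd , p≤L , d-odd
  where
  p-odd : p % 2 ≡ 1
  p-odd with even-or-odd p
  ... | inj₂ odd = odd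
  ... | inj₁ even =
    contradiction (trans (sym (even-suc L L-even)) (trans (cong (_% 2) 1+L≡kp) (*-evenʳ (suc (suc k′)) p even))) λ ()
  -- 1 + L = kp ≥ 2p ≥ p + 1
  p≤L : p ≤ L
  p≤L = s≤s⁻¹ (subst₂ _≤_ (+-comm p 1) (sym 1+L≡kp)
                (+-monoʳ-≤ p (≤-trans (odd⇒positive p-odd) (m≤m+n p (k′ * p)))))
  d-odd : (L ∸ p) % 2 ≡ 1
  d-odd with even-or-odd (L ∸ p)
  ... | inj₂ odd = odd
  ... | inj₁ even =
    contradiction (trans (sym L-even) (trans (cong (_% 2) (sym (m∸n+n≡m p≤L))) (+-even-odd (L ∸ p) p even p-odd))) λ ()

Alt : ℕ → ℕ → ℕ → Set
Alt zero x y = x < y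
Alt (suc d) x y = Alt d y x

alt-even : ∀ d {x y} → d % 2 ≡ 0 → Alt d x y → x < y
alt-even zero _ lt = lt
alt-even (suc (suc d)) e lt = alt-even d e lt

alt-odd : ∀ d {x y} → d % 2 ≡ 1 → Alt d x y → y < x
alt-odd (suc zero) _ lt = lt
alt-odd (suc (suc d)) e lt = alt-odd d e lt

Preserves Reverses : ℕ → ℕ → ℕ → ℕ → Set
Preserves x y x′ y′ = (x < y → x′ < y′) × (y < x → y′ < x′)
Reverses x y x′ y′ = (x < y → y′ < x′) × (y < x → x′ < y′)

Adjacent : ℕ → ℕ → Set
Adjacent x y = y ≡ suc x ⊎ x ≡ suc y

far-above : ∀ {x y} → x + 2 ≤ y → ¬ Adjacent x y
far-above {x} x+2≤y (inj₁ refl) = n≮n (suc x) (subst (_≤ suc x) (+-comm x 2) x+2≤y)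
far-above {y = y} x+2≤y (inj₂ refl) = n≮n y (≤-trans (m≤m+n (suc y) 2) x+2≤y)

far-below : ∀ {x y} → y + 2 ≤ x → ¬ Adjacent x y
far-below y+2≤x adj = far-above y+2≤x (swap adj)
  where
  swap : ∀ {x y} → Adjacent x y → Adjacent y x
  swap (inj₁ e) = inj₂ e
  swap (inj₂ e) = inj₁ e

-- A sequence whose steps all compare like a fixed pair x ≠ y moves by at
-- least one per step; after K ≥ 2 steps it is no longer adjacent to its start.
monotone-far : ∀ (U : ℕ → ℕ) K {x y} → 2 ≤ K → x ≢ y →
               (∀ j → j < K → Preserves x y (U j) (U (suc j))) → ¬ Adjacent (U 0) (U K)
monotone-far U K {x} {y} 2≤K x≢y steps with <-cmp x y
... | tri≈ _ e _ = contradiction e x≢y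
... | tri< up _ _ = far-above (≤-trans (+-monoʳ-≤ (U 0) 2≤K) (ascend K ≤-refl))
  where
  ascend : ∀ j → j ≤ K → U 0 + j ≤ U j
  ascend zero _ = ≤-reflexive (+-identityʳ (U 0))
  ascend (suc j) j<K = subst (_≤ U (suc j)) (sym (+-suc (U 0) j))
                             (≤-<-trans (ascend j (<⇒≤ j<K)) (proj₁ (steps j j<K) up))
... | tri> _ _ down = far-below (≤-trans (+-monoʳ-≤ (U K) 2≤K) (descend K ≤-refl))
  where
  descend : ∀ j → j ≤ K → U j + j ≤ U 0
  descend zero _ = ≤-reflexive (+-identityʳ (U 0))
  descend (suc j) j<K = subst (_≤ U 0) (sym (+-suc (U (suc j)) j))
                              (<-≤-trans (+-monoˡ-< j (proj₂ (steps j j<K) down)) (descend j (<⇒≤ j<K)))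

four-point : ∀ {t₀ t₁ tₖ tₙ} → t₀ ≢ t₁ → t₀ ≢ tₖ → Preserves t₀ t₁ tₖ tₙ → Reverses t₀ tₖ t₁ tₙ →
             ¬ Adjacent t₀ tₙ
four-point {t₀} {t₁} {tₖ} {tₙ} t₀≢t₁ t₀≢tₖ (up , down) (up′ , down′) adj with <-cmp t₀ t₁ | adj
... | tri≈ _ e _ | _ = t₀≢t₁ e
... | tri< t₀<t₁ _ _ | inj₁ refl = <⇒≱ t₀<t₁ (s≤s⁻¹ (down′ tₖ<t₀))
  where
  tₖ<t₀ : tₖ < t₀
  tₖ<t₀ = ≤∧≢⇒< (s≤s⁻¹ (up t₀<t₁)) (t₀≢tₖ ∘ sym)
... | tri< t₀<t₁ _ _ | inj₂ refl = <-asym t₀<t₁ (<-trans (down′ (<-trans (up t₀<t₁) ≤-refl)) ≤-refl)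
... | tri> _ _ t₁<t₀ | inj₁ refl = <-asym t₁<t₀ (<-trans ≤-refl (up′ (<-trans ≤-refl (down t₁<t₀))))
... | tri> _ _ t₁<t₀ | inj₂ refl = <⇒≱ t₁<t₀ (up′ t₀<tₖ)
  where
  t₀<tₖ : t₀ < tₖ
  t₀<tₖ = ≤∧≢⇒< (down t₁<t₀) t₀≢tₖ

Agree : (ℕ → ℕ) → ℕ → ℕ → ℕ → Set
Agree w a b d = ∀ t → t < d → w (a + t) ≡ w (b + t)

agree-sym : ∀ w {a b d} → Agree w a b d → Agree w b a d
agree-sym w agree t lt = sym (agree t lt)

Periodic : (ℕ → ℕ) → ℕ → ℕ → ℕ → Set
Periodic w b p L = ∀ t → t + p < L → w (b + t) ≡ w (b + (t + p))

periodic-multiple : ∀ w {b p L} → Periodic w b p L → ∀ c → Periodic w b (c * p) L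
periodic-multiple w {b} per zero t _ = cong (λ x → w (b + x)) (sym (+-identityʳ t))
periodic-multiple w {b} {p} {L} per (suc c) t lt = begin
  w (b + t)                     ≡⟨ per t (≤-<-trans (+-monoʳ-≤ t (m≤m+n p (c * p))) lt) ⟩
  w (b + (t + p))               ≡⟨ periodic-multiple w per c (t + p) (subst (_< L) (sym (+-assoc t p (c * p))) lt) ⟩
  w (b + (t + p + c * p))       ≡⟨ cong (λ x → w (b + x)) (+-assoc t p (c * p)) ⟩
  w (b + (t + (p + c * p)))     ∎
  where open ≡-Reasoning

periodic-agree : ∀ w {b q L d} → Periodic w b q L → q + d ≤ L → Agree w b (b + q) d
periodic-agree w {b} {q} {L} {d} per q+d≤L t t<d =
  trans (per t (<-≤-trans (subst (_< q + d) (+-comm q t) (+-monoʳ-< q t<d)) q+d≤L))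
        (cong w (trans (cong (b +_) (+-comm t q)) (sym (+-assoc b q t))))

prefix-of-power : ∀ {w b L} V s k → (∀ t → t < L → at V t ≡ w (b + t)) → L ≤ length V → V ≡ pow s k →
                  Periodic w b (length s) L
prefix-of-power {w} {b} V [] k letters _ _ t _ = cong (λ x → w (b + x)) (sym (+-identityʳ t))
prefix-of-power {w} {b} {L} V s@(_ ∷ _) k letters L≤V V≡sᵏ t lt = begin
  w (b + t)                       ≡⟨ sym (letters t (≤-<-trans (m≤m+n t (length s)) lt)) ⟩
  at V t                          ≡⟨ cong (λ X → at X t) V≡sᵏ ⟩
  at (pow s k) t                  ≡⟨ at-pow s k t (≤-<-trans (m≤m+n t (length s)) in-power) ⟩
  at s (t % length s)             ≡⟨ cong (at s) (sym ([m+n]%n≡m%n t (length s))) ⟩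
  at s ((t + length s) % length s) ≡⟨ sym (at-pow s k (t + length s) in-power) ⟩
  at (pow s k) (t + length s)     ≡⟨ cong (λ X → at X (t + length s)) (sym V≡sᵏ) ⟩
  at V (t + length s)             ≡⟨ letters (t + length s) lt ⟩
  w (b + (t + length s))          ∎
  where
  open ≡-Reasoning
  in-power : t + length s < k * length s
  in-power = <-≤-trans lt (≤-trans L≤V (≤-reflexive (trans (cong length V≡sᵏ) (length-pow s k))))

module Positions {n : ℕ} (π : Perm n) where

  π-injective : ∀ {a b} → 1 ≤ a → a ≤ n → 1 ≤ b → b ≤ n → fun π a ≡ fun π b → a ≡ b
  π-injective {a} {b} a≥1 a≤n b≥1 b≤n e =
    trans (sym (inv-fun π a a≥1 a≤n)) (trans (cong (inv π) e) (inv-fun π b b≥1 b≤n))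

  avoids-last : ∀ {i} → 1 ≤ i → i < n → fun π i ≢ fun π n
  avoids-last i≥1 i<n e = <⇒≢ i<n (π-injective i≥1 (<⇒≤ i<n) (≤-trans i≥1 (<⇒≤ i<n)) ≤-refl e)

  shift-differs : ∀ {b s} → 1 ≤ b → 0 < s → b + s ≤ n → fun π b ≢ fun π (b + s)
  shift-differs {b} {s} b≥1 s>0 b+s≤n e =
    <⇒≢ (m<m+n b s>0) (π-injective b≥1 (≤-trans (m≤m+n b s) b+s≤n) (≤-trans b≥1 (m≤m+n b s)) b+s≤n e)

  record Neighbour (b : ℕ) : Set where
    field
      positive : 1 ≤ b
      before-n : b < n
      adjacent : Adjacent (fun π b) (fun π n)

  window-nonempty : ∀ {b x} → Neighbour b → b + x ≡ n → x ≢ 0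
  window-nonempty {b} nb e refl = <⇒≢ (Neighbour.before-n nb) (trans (sym (+-identityʳ b)) e)

  module Holder (c : ℕ) (c≥1 : 1 ≤ c) (c≤n : c ≤ n) where
    holder-range : 1 ≤ inv π c × inv π c ≤ n
    holder-range = inv-range π c c≥1 c≤n

    holds : fun π (inv π c) ≡ c
    holds = fun-inv π c c≥1 c≤n

    holder-before-n : c ≢ fun π n → inv π c < n
    holder-before-n c≢π[n] = ≤∧≢⇒< (proj₂ holder-range) (λ e → c≢π[n] (trans (sym holds) (cong (fun π) e)))

  module Left (n≥1 : 1 ≤ n) (π[n]≢1 : fun π n ≢ 1) where
    private
      π[n]≥1 : 1 ≤ fun π n
      π[n]≥1 = proj₁ (fun-range π n n≥1 ≤-refl)
    below-π[n] : suc (fun π n ∸ 1) ≡ fun π n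
    below-π[n] = m+[n∸m]≡n π[n]≥1
    private
      c≥1 : 1 ≤ fun π n ∸ 1
      c≥1 = s≤s⁻¹ (subst (2 ≤_) (sym below-π[n]) (≤∧≢⇒< π[n]≥1 (π[n]≢1 ∘ sym)))
    open Holder (fun π n ∸ 1) c≥1 (≤-trans (m∸n≤m (fun π n) 1) (proj₂ (fun-range π n n≥1 ≤-refl))) public

  module Right (n≥1 : 1 ≤ n) (π[n]≢n : fun π n ≢ n) where
    open Holder (suc (fun π n)) (s≤s z≤n) (≤∧≢⇒< (proj₂ (fun-range π n n≥1 ≤-refl)) π[n]≢n) public

  ℓ-neighbour : 1 ≤ n → fun π n ≢ 1 → Neighbour (ℓIdx π)
  ℓ-neighbour n≥1 π[n]≢1 = record
    { positive = proj₁ holder-range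
    ; before-n = holder-before-n (λ e → 1+n≢n (trans below-π[n] (sym e)))
    ; adjacent = inj₁ (trans (sym below-π[n]) (cong suc (sym holds)))
    }
    where open Left n≥1 π[n]≢1

  r-neighbour : 1 ≤ n → fun π n ≢ n → Neighbour (rIdx π)
  r-neighbour n≥1 π[n]≢n = record
    { positive = proj₁ holder-range
    ; before-n = holder-before-n 1+n≢n
    ; adjacent = inj₂ holds
    }
    where open Right n≥1 π[n]≢n

  -- ℓ and r are different positions (their values differ by 2)
  ℓ≢r : 1 ≤ n → fun π n ≢ 1 → fun π n ≢ n → ℓIdx π ≢ rIdx π
  ℓ≢r n≥1 π[n]≢1 π[n]≢n ℓ≡r = <⇒≢ (s≤s (m∸n≤m (fun π n) 1))
    (trans (sym (Left.holds n≥1 π[n]≢1)) (trans (cong (fun π) ℓ≡r) (Right.holds n≥1 π[n]≢n)))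

≢⇒T-not-≡ᵇ : ∀ {m n} → m ≢ n → T (not (m ≡ᵇ n))
≢⇒T-not-≡ᵇ {m} {n} m≢n with m ≡ᵇ n in eq
... | false = tt
... | true = m≢n (≡ᵇ⇒≡ m n (subst T (sym eq) tt))

module SlopeWord {n : ℕ} (π : Perm n) (w : ℕ → ℕ)
  (slope : ∀ i j → 1 ≤ i → i < n → 1 ≤ j → j < n → fun π i < fun π j → z π j + w i ≤ w j + z π i) where

  open Positions π

  next : ℕ → ℕ
  next c = fun π (suc (inv π c))

  -- Contrapositives of the two clauses of zCond: where zCond fails away from
  -- π(n), next does not increase from c to c+1 ...
  zCond-regular : ∀ c → c ≢ fun π n → suc c ≢ fun π n → zCond π c ≡ false → next (suc c) ≤ next c
  zCond-regular c c≢π[n] c+1≢π[n] off = ≮⇒≥ λ lt →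
    subst T off (Equivalence.from T-∨ (inj₁ (Equivalence.from T-∧
      (≢⇒T-not-≡ᵇ c≢π[n] , Equivalence.from T-∧ (≢⇒T-not-≡ᵇ c+1≢π[n] , <⇒<ᵇ lt)))))

  -- ... and where it fails just below π(n) < n, next does not increase from
  -- π(n)−1 to π(n)+1 (this is the comparison of π(ℓ+1) and π(r+1)).
  zCond-bridge : ∀ c → suc c ≡ fun π n → fun π n ≢ n → zCond π c ≡ false → next (suc (suc c)) ≤ next c
  zCond-bridge c c+1≡π[n] π[n]≢n off = ≮⇒≥ λ lt →
    subst T off (Equivalence.from T-∨ (inj₂ (Equivalence.from T-∧
      (≡⇒≡ᵇ (suc c) (fun π n) c+1≡π[n] , Equivalence.from T-∧ (≢⇒T-not-≡ᵇ π[n]≢n , <⇒<ᵇ (ℓ<r lt))))))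
    where
    ℓ<r : next c < next (suc (suc c)) → fun π (suc (ℓIdx π)) < fun π (suc (rIdx π))
    ℓ<r = subst₂ _<_ (cong (λ v → next (v ∸ 1)) c+1≡π[n]) (cong (λ v → next (suc v)) c+1≡π[n])

  -- If zCond fails on all of [a, b) (a ≠ π(n), b ≤ n), then next c ≤ next a
  -- for every c ∈ [a, b] other than π(n); the value π(n) itself is bridged.
  -- By induction on d, where c = d + a.
  descent : ∀ {a b} → a ≢ fun π n → b ≤ n → (∀ c → a ≤ c → c < b → zCond π c ≡ false) →
            ∀ d → d + a ≤ b → d + a ≢ fun π n → next (d + a) ≤ next a
  descent a≢π[n] b≤n off zero _ _ = ≤-refl
  descent {a} a≢π[n] b≤n off (suc zero) le ne = zCond-regular a a≢π[n] ne (off a ≤-refl le)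
  descent {a} {b} a≢π[n] b≤n off (suc (suc d)) le ne =
    by-cases (suc d + a ≟ fun π n) (descent a≢π[n] b≤n off (suc d) (<⇒≤ le))
             (descent a≢π[n] b≤n off d (≤-trans (n≤1+n _) (<⇒≤ le)))
    where
    -- the value before c is either regular or π(n), which is then jumped over
    by-cases : Dec (suc d + a ≡ fun π n) → (suc d + a ≢ fun π n → next (suc d + a) ≤ next a) →
               (d + a ≢ fun π n → next (d + a) ≤ next a) → next (suc (suc d) + a) ≤ next a
    by-cases (no c≢π[n]) from-c _ =
      ≤-trans (zCond-regular (suc d + a) c≢π[n] ne (off _ (m≤n+m a (suc d)) le)) (from-c c≢π[n])
    by-cases (yes c≡π[n]) _ from-c-1 =
      ≤-trans (zCond-bridge (d + a) c≡π[n] π[n]≢n (off _ (m≤n+m a d) (<-trans (n<1+n _) le)))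
              (from-c-1 (λ e → 1+n≢n (trans c≡π[n] (sym e))))
      where
      π[n]≢n : fun π n ≢ n
      π[n]≢n e = <⇒≢ (≤-trans le b≤n) (trans c≡π[n] e)

  descent-to : ∀ {a b c} → a ≢ fun π n → b ≤ n → (∀ c → a ≤ c → c < b → zCond π c ≡ false) →
               a ≤ c → c ≤ b → c ≢ fun π n → next c ≤ next a
  descent-to {a} {b} {c} a≢π[n] b≤n off a≤c c≤b c≢π[n] =
    subst (λ x → next x ≤ next a) c-a+a≡c
          (descent a≢π[n] b≤n off (c ∸ a) (subst (_≤ b) (sym c-a+a≡c) c≤b) (subst (_≢ fun π n) (sym c-a+a≡c) c≢π[n]))
    where
    c-a+a≡c : c ∸ a + a ≡ c
    c-a+a≡c = m∸n+n≡m a≤c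

  -- By the slope condition
  -- z_j ≤ z_i, so zCond fails on all of [π(i), π(j)) and descent applies.
  swap-step : ∀ {i j} → 1 ≤ i → i < n → 1 ≤ j → j < n → fun π i < fun π j → w i ≡ w j →
              fun π (suc j) < fun π (suc i)
  swap-step {i} {j} i≥1 i<n j≥1 j<n πi<πj wi≡wj = ≤∧≢⇒< next-j≤next-i next-j≢next-i
    where
    πi≥1 : 1 ≤ fun π i
    πi≥1 = proj₁ (fun-range π i i≥1 (<⇒≤ i<n))
    πj≤n : fun π j ≤ n
    πj≤n = proj₂ (fun-range π j j≥1 (<⇒≤ j<n))
    zj≤zi : z π j ≤ z π i
    zj≤zi = +-cancelʳ-≤ (w j) (z π j) (z π i)
              (subst₂ (λ x y → z π j + x ≤ y) wi≡wj (+-comm (w j) (z π i)) (slope i j i≥1 i<n j≥1 j<n πi<πj))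
    -- z_j = z_i + #{c ∈ [π(i), π(j)) : zCond c}
    no-zCond : count (zCond π) (fun π i) (fun π j) ≡ 0
    no-zCond = n≤0⇒n≡0 (+-cancelˡ-≤ (z π i) _ 0
                 (subst₂ _≤_ (count-split (zCond π) πi≥1 (<⇒≤ πi<πj)) (sym (+-identityʳ (z π i))) zj≤zi))
    next-j≤next-i : fun π (suc j) ≤ fun π (suc i)
    next-j≤next-i = subst₂ (λ x y → fun π (suc x) ≤ fun π (suc y))
                           (inv-fun π j j≥1 (<⇒≤ j<n)) (inv-fun π i i≥1 (<⇒≤ i<n))
                      (descent-to (avoids-last i≥1 i<n) πj≤n (λ c → count-zero (zCond π) no-zCond)
                                  (<⇒≤ πi<πj) ≤-refl (avoids-last j≥1 j<n))
    next-j≢next-i : fun π (suc j) ≢ fun π (suc i)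
    next-j≢next-i e = <⇒≢ πi<πj (cong (fun π) (sym (suc-injective (π-injective z<s j<n z<s i<n e))))

  record Windows (a b d : ℕ) : Set where
    field
      a≥1 : 1 ≤ a
      b≥1 : 1 ≤ b
      a+d≤n : a + d ≤ n
      b+d≤n : b + d ≤ n
      agree : Agree w a b d

  windows-sym : ∀ {a b d} → Windows a b d → Windows b a d
  windows-sym W = record { a≥1 = b≥1 ; b≥1 = a≥1 ; a+d≤n = b+d≤n ; b+d≤n = a+d≤n ; agree = agree-sym w agree }
    where open Windows W

  transport : ∀ d {a b} → Windows a b d → fun π a < fun π b → Alt d (fun π (a + d)) (fun π (b + d))
  transport zero {a} {b} _ lt = subst₂ (λ x y → fun π x < fun π y) (sym (+-identityʳ a)) (sym (+-identityʳ b)) lt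
  transport (suc d) {a} {b} W lt =
    subst₂ (λ x y → Alt d (fun π x) (fun π y)) (sym (+-suc b d)) (sym (+-suc a d))
           (transport d shifted (swap-step a≥1 (before a+d≤n) b≥1 (before b+d≤n) lt first-letters))
    where
    open Windows W
    before : ∀ {x} → x + suc d ≤ n → x < n
    before {x} le = <-≤-trans (m<m+n x z<s) le
    first-letters : w a ≡ w b
    first-letters = subst₂ (λ x y → w x ≡ w y) (+-identityʳ a) (+-identityʳ b) (agree 0 z<s)
    shifted : Windows (suc b) (suc a) d
    shifted = record
      { a≥1 = s≤s z≤n
      ; b≥1 = s≤s z≤n
      ; a+d≤n = subst (_≤ n) (+-suc b d) b+d≤n
      ; b+d≤n = subst (_≤ n) (+-suc a d) a+d≤n
      ; agree = λ t t<d → sym (subst₂ (λ x y → w x ≡ w y) (+-suc a t) (+-suc b t) (agree (suc t) (s<s t<d)))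
      }

  transport-even : ∀ {a b d a′ b′} → d % 2 ≡ 0 → Windows a b d → a + d ≡ a′ → b + d ≡ b′ →
                   Preserves (fun π a) (fun π b) (fun π a′) (fun π b′)
  transport-even {d = d} even W refl refl = (λ lt → alt-even d even (transport d W lt))
                                          , (λ lt → alt-even d even (transport d (windows-sym W) lt))

  transport-odd : ∀ {a b d a′ b′} → d % 2 ≡ 1 → Windows a b d → a + d ≡ a′ → b + d ≡ b′ →
                  Reverses (fun π a) (fun π b) (fun π a′) (fun π b′)
  transport-odd {d = d} odd W refl refl = (λ lt → alt-odd d odd (transport d W lt))
                                        , (λ lt → alt-odd d odd (transport d (windows-sym W) lt))

  -- An even period q repeated K ≥ 2 times from b up to n: transport over jq
  -- letters preserves order, so the values π(b + jq) move monotonically and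
  -- π(b), π(n) are at least K apart.
  even-period-far : ∀ {b q K} → 1 ≤ b → 0 < q → q % 2 ≡ 0 → 2 ≤ K → b + K * q ≡ n →
                    Periodic w b q (K * q) → ¬ Adjacent (fun π b) (fun π n)
  even-period-far {b} {q} {K} b≥1 q>0 q-even 2≤K b+Kq≡n per adj =
    monotone-far U K 2≤K (shift-differs b≥1 q>0 b+q≤n) steps
      (subst₂ Adjacent (cong (fun π) (sym (+-identityʳ b))) (cong (fun π) (sym b+Kq≡n)) adj)
    where
    U : ℕ → ℕ
    U j = fun π (b + j * q)
    inside : ∀ {j} → j ≤ K → b + j * q ≤ n
    inside j≤K = subst (_ ≤_) b+Kq≡n (+-monoʳ-≤ b (*-monoˡ-≤ q j≤K))
    b+q≤n : b + q ≤ n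
    b+q≤n = subst (λ x → b + x ≤ n) (*-identityˡ q) (inside (≤-trans (s≤s z≤n) 2≤K))
    steps : ∀ j → j < K → Preserves (fun π b) (fun π (b + q)) (U j) (U (suc j))
    steps j j<K = transport-even (*-evenʳ j q q-even) windows refl (+-assoc b q (j * q))
      where
      windows : Windows b (b + q) (j * q)
      windows = record
        { a≥1 = b≥1
        ; b≥1 = ≤-trans b≥1 (m≤m+n b q)
        ; a+d≤n = inside (<⇒≤ j<K)
        ; b+d≤n = subst (_≤ n) (sym (+-assoc b q (j * q))) (inside j<K)
        ; agree = periodic-agree w per (*-monoˡ-≤ q j<K)
        }

  -- Transport over k₁p (even) letters from (b, b+p) and over p (odd) letters
  -- from (b, b+k₁p) relates the four values at b, b+p, b+k₁p, n as in four-point.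
  odd-period-far : ∀ {b p k₁} → 1 ≤ b → p % 2 ≡ 1 → k₁ % 2 ≡ 0 → 1 ≤ k₁ → b + suc k₁ * p ≡ n →
                   Periodic w b p (suc k₁ * p) → ¬ Adjacent (fun π b) (fun π n)
  odd-period-far {b} {p} {k₁} b≥1 p-odd k₁-even k₁≥1 b+kp≡n per =
    four-point (shift-differs b≥1 (odd⇒positive p-odd) b+p≤n) (shift-differs b≥1 k₁p>0 b+k₁p≤n)
               (transport-even (*-evenˡ k₁ p k₁-even) windows₁ refl (trans (+-assoc b p (k₁ * p)) b+kp≡n))
               (transport-odd p-odd windows₂ refl b+k₁p+p≡n)
    where
    k₁p>0 : 0 < k₁ * p
    k₁p>0 = *-mono-≤ k₁≥1 (odd⇒positive p-odd)
    b+k₁p+p≡n : b + k₁ * p + p ≡ n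
    b+k₁p+p≡n = trans (+-assoc b (k₁ * p) p) (trans (cong (b +_) (+-comm (k₁ * p) p)) b+kp≡n)
    b+k₁p≤n : b + k₁ * p ≤ n
    b+k₁p≤n = subst (_ ≤_) b+k₁p+p≡n (m≤m+n _ p)
    b+p≤n : b + p ≤ n
    b+p≤n = subst (_ ≤_) (trans (+-assoc b p (k₁ * p)) b+kp≡n) (m≤m+n _ (k₁ * p))
    windows₁ : Windows b (b + p) (k₁ * p)
    windows₁ = record
      { a≥1 = b≥1 ; b≥1 = ≤-trans b≥1 (m≤m+n b p) ; a+d≤n = b+k₁p≤n
      ; b+d≤n = ≤-reflexive (trans (+-assoc b p (k₁ * p)) b+kp≡n)
      ; agree = periodic-agree w per ≤-refl
      }
    windows₂ : Windows b (b + k₁ * p) p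
    windows₂ = record
      { a≥1 = b≥1 ; b≥1 = ≤-trans b≥1 (m≤m+n b _) ; a+d≤n = b+p≤n ; b+d≤n = ≤-reflexive b+k₁p+p≡n
      ; agree = periodic-agree w (periodic-multiple w per k₁) (≤-reflexive (+-comm (k₁ * p) p))
      }

  -- A window w_[b,n) of period p and length kp, starting at a neighbour b:
  -- unless k = 1 or (k = 2 and p odd), either an even period repeats at least
  -- twice (p even, or p odd and k ≥ 4 even, with period 2p) or an odd period
  -- repeats an odd number k ≥ 3 of times; both contradict adjacency.
  neighbour-exponent : ∀ {b} → Neighbour b → ∀ k p → b + k * p ≡ n → Periodic w b p (k * p) →
                       k ≡ 1 ⊎ (k ≡ 2 × p % 2 ≡ 1)
  neighbour-exponent {b} nb zero p e _ = contradiction refl (window-nonempty nb e)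
  neighbour-exponent {b} nb (suc zero) p _ _ = inj₁ refl
  neighbour-exponent {b} nb (suc (suc k′)) zero e _ = contradiction (*-zeroʳ (suc (suc k′))) (window-nonempty nb e)
  neighbour-exponent {b} nb (suc (suc k′)) p@(suc _) e per with even-or-odd p | even-or-odd k′
  ... | inj₁ p-even | _ =
    contradiction (Neighbour.adjacent nb)
      (even-period-far {b} {p} {suc (suc k′)} (Neighbour.positive nb) z<s p-even (s≤s (s≤s z≤n)) e per)
  ... | inj₂ p-odd | inj₂ k′-odd =
    contradiction (Neighbour.adjacent nb)
      (odd-period-far {b} {p} {suc k′} (Neighbour.positive nb) p-odd (odd-suc k′ k′-odd) (s≤s z≤n) e per)
  ... | inj₂ p-odd | inj₁ k′-even with m%n≡0⇒n∣m k′ 2 k′-even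
  ...   | divides zero refl = inj₂ (refl , p-odd)
  ...   | divides (suc h) refl =
    contradiction (Neighbour.adjacent nb)
      (even-period-far {b} {2 * p} {suc (suc h)} (Neighbour.positive nb) z<s (*-evenˡ 2 p refl) (s≤s (s≤s z≤n))
                       (trans (cong (b +_) (sym K*2*p)) e)
                       (subst (Periodic w b (2 * p)) K*2*p (periodic-multiple w per 2)))
    where
    K*2*p : suc (suc h) * 2 * p ≡ suc (suc h) * (2 * p)
    K*2*p = *-assoc (suc (suc h)) 2 p

  -- If π(b) is adjacent to π(n) (b < n), the window w_[b,n) is almost primitive:
  -- a factorisation sᵏ makes it a window of period |s| and length k|s|.
  neighbour⇒almost-primitive : ∀ {b} → Neighbour b → AlmostPrimitive (slice w b n)
  neighbour⇒almost-primitive {b} nb s k slice≡sᵏ = neighbour-exponent nb k (length s) b+kp≡n periodic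
    where
    n∸b≡kp : n ∸ b ≡ k * length s
    n∸b≡kp = trans (sym (slice-length w b n)) (trans (cong length slice≡sᵏ) (length-pow s k))
    b+kp≡n : b + k * length s ≡ n
    b+kp≡n = trans (cong (b +_) (sym n∸b≡kp)) (m+[n∸m]≡n (<⇒≤ (Neighbour.before-n nb)))
    periodic : Periodic w b (length s) (k * length s)
    periodic = subst (Periodic w b (length s)) n∸b≡kp
                 (prefix-of-power {w} {b} {n ∸ b} (slice w b n) s k (slice-at w b n)
                                  (≤-reflexive (sym (slice-length w b n))) slice≡sᵏ)

  -- If π(n) = 1 and L = n − m is even (m = π⁻¹(n)), then w_[m,n)0 is primitive:
  -- from w_[m,n)0 = sᵏ with k ≥ 2, the period p = |s| is odd (kp = L + 1) and
  -- p ≤ L; transport over the odd number L − p of letters from (m + p, m), where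
  -- π(m + p) < π(m) = n, gives π(m + L − p) < π(n) = 1, which is impossible.
  last-minimal⇒primitive : 1 ≤ n → fun π n ≡ 1 → (n ∸ inv π n) % 2 ≡ 0 →
                           Primitive (slice w (inv π n) n ++ 0 ∷ [])
  last-minimal⇒primitive n≥1 π[n]≡1 L-even s _ V≡sᵏ = exponent _ V≡sᵏ
    where
    m L : ℕ
    m = inv π n
    L = n ∸ m
    V : List ℕ
    V = slice w m n ++ 0 ∷ []
    m≥1 : 1 ≤ m
    m≥1 = proj₁ (inv-range π n n≥1 ≤-refl)
    π[m]≡n : fun π m ≡ n
    π[m]≡n = fun-inv π n n≥1 ≤-refl
    m+L≡n : m + L ≡ n
    m+L≡n = m+[n∸m]≡n (proj₂ (inv-range π n n≥1 ≤-refl))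
    |V|≡1+L : length V ≡ suc L
    |V|≡1+L = trans (length-++ (slice w m n)) (trans (cong (_+ 1) (slice-length w m n)) (+-comm L 1))
    letters : ∀ t → t < L → at V t ≡ w (m + t)
    letters t lt = trans (at-++ˡ (slice w m n) (0 ∷ []) (subst (t <_) (sym (slice-length w m n)) lt)) (slice-at w m n t lt)
    no-proper-power : ∀ k′ → V ≡ pow s (suc (suc k′)) → ⊥
    no-proper-power k′ e = <⇒≱ (proj₁ (transport-odd d-odd windows end refl) π[m+p]<π[m])
                               (subst (_≤ fun π (m + d)) (sym π[n]≡1) (proj₁ (fun-range π (m + d) m+d≥1 m+d≤n)))
      where
      k p : ℕ
      k = suc (suc k′)
      p = length s
      1+L≡kp : suc L ≡ k * p
      1+L≡kp = trans (sym |V|≡1+L) (trans (cong length e) (length-pow s k))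
      factor : p % 2 ≡ 1 × p ≤ L × (L ∸ p) % 2 ≡ 1
      factor = odd-proper-factor k′ L-even 1+L≡kp
      d : ℕ
      d = L ∸ p
      d-odd : d % 2 ≡ 1
      d-odd = proj₂ (proj₂ factor)
      L≡p+d : p + d ≡ L
      L≡p+d = m+[n∸m]≡n (proj₁ (proj₂ factor))
      end : m + p + d ≡ n
      end = trans (+-assoc m p d) (trans (cong (m +_) L≡p+d) m+L≡n)
      m+p≤n : m + p ≤ n
      m+p≤n = subst (m + p ≤_) end (m≤m+n (m + p) d)
      m+d≥1 : 1 ≤ m + d
      m+d≥1 = ≤-trans m≥1 (m≤m+n m d)
      m+d≤n : m + d ≤ n
      m+d≤n = ≤-trans (+-monoˡ-≤ d (m≤m+n m p)) (≤-reflexive end)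
      windows : Windows (m + p) m d
      windows = record
        { a≥1 = ≤-trans m≥1 (m≤m+n m p) ; b≥1 = m≥1 ; a+d≤n = ≤-reflexive end ; b+d≤n = m+d≤n
        ; agree = agree-sym w (periodic-agree w periodic (≤-reflexive L≡p+d))
        }
        where
        periodic : Periodic w m p L
        periodic = prefix-of-power {w} {m} {L} V s k letters (≤-trans (n≤1+n L) (≤-reflexive (sym |V|≡1+L))) e
      -- π(m) = n is the largest value
      π[m+p]<π[m] : fun π (m + p) < fun π m
      π[m+p]<π[m] = subst (fun π (m + p) <_) (sym π[m]≡n)
                      (≤∧≢⇒< (proj₂ (fun-range π (m + p) (≤-trans m≥1 (m≤m+n m p)) m+p≤n))
                             (λ eq → shift-differs m≥1 (odd⇒positive (proj₁ factor)) m+p≤n (trans π[m]≡n (sym eq))))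
    exponent : ∀ k → V ≡ pow s k → s ≡ V × k ≡ 1
    exponent zero e = contradiction (trans (sym |V|≡1+L) (cong length e)) λ ()
    exponent (suc zero) e = sym (trans e (++-identityʳ s)) , refl
    exponent (suc (suc k′)) e = ⊥-elim (no-proper-power k′ e)

-- For π(n) ∉ {1, n}: z_[ℓ,n) and z_[r,n) have the same infinite power iff π
-- is collapsed.  The word z satisfies the slope condition (with equality), so
-- both are almost primitive, and same-power⇒square applies.
collapse-criterion : ∀ {n} (π : Perm n) → 1 ≤ n → fun π n ≢ 1 → fun π n ≢ n →
  (∀ i → omega (slice (z π) (ℓIdx π) n) i ≡ omega (slice (z π) (rIdx π) n) i) ⇔ Collapsed π
collapse-criterion {n} π n≥1 π[n]≢1 π[n]≢n =
  mk⇔ (λ same → π[n]≢1 , π[n]≢n , same-power⇒square u v (almost-primitive ℓ-nb) (almost-primitive r-nb)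
                                     (nonempty ℓ-nb) (nonempty r-nb) |u|≢|v| same)
      from-collapsed
  where
  open Positions π
  open SlopeWord π (z π) (λ _ _ _ _ _ _ _ → ≤-refl) renaming (neighbour⇒almost-primitive to almost-primitive)
  u v : List ℕ
  u = slice (z π) (ℓIdx π) n
  v = slice (z π) (rIdx π) n
  ℓ-nb : Neighbour (ℓIdx π)
  ℓ-nb = ℓ-neighbour n≥1 π[n]≢1
  r-nb : Neighbour (rIdx π)
  r-nb = r-neighbour n≥1 π[n]≢n
  nonempty : ∀ {b} → Neighbour b → 0 < length (slice (z π) b n)
  nonempty {b} nb = subst (0 <_) (sym (slice-length (z π) b n)) (m<n⇒0<n∸m (Neighbour.before-n nb))
  -- the lengths n − ℓ and n − r differ since ℓ ≠ r
  |u|≢|v| : length u ≢ length v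
  |u|≢|v| e = ℓ≢r n≥1 π[n]≢1 π[n]≢n
    (∸-cancelˡ-≡ (<⇒≤ (Neighbour.before-n ℓ-nb)) (<⇒≤ (Neighbour.before-n r-nb))
                 (trans (sym (slice-length (z π) (ℓIdx π) n)) (trans e (slice-length (z π) (rIdx π) n))))
  from-collapsed : Collapsed π → ∀ i → omega u i ≡ omega v i
  from-collapsed (_ , _ , inj₁ u≡vv) i =
    trans (cong (λ x → omega x i) u≡vv) (omega-square v i {{>-nonZero (nonempty r-nb)}})
  from-collapsed (_ , _ , inj₂ v≡uu) i =
    sym (trans (cong (λ x → omega x i) v≡uu) (omega-square u i {{>-nonZero (nonempty ℓ-nb)}}))

lemma5 : (n : ℕ) → 1 ≤ n → (π : Perm n) (w : ℕ → ℕ) →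
    (∀ i j → 1 ≤ i → i < n → 1 ≤ j → j < n → fun π i < fun π j →
      z π j + w i ≤ w j + z π i) →
    ((fun π n ≡ 1 → (n ∸ mIdx π) % 2 ≡ 0 →
        Primitive (slice w (mIdx π) n ++ (0 ∷ []))) ×
     (¬ (fun π n ≡ 1) → AlmostPrimitive (slice w (ℓIdx π) n)) ×
     (¬ (fun π n ≡ n) → AlmostPrimitive (slice w (rIdx π) n)) ×
     (¬ (fun π n ≡ 1) → ¬ (fun π n ≡ n) →
        ((∀ i → omega (slice (z π) (ℓIdx π) n) i ≡ omega (slice (z π) (rIdx π) n) i)
          ⇔ Collapsed π)))
lemma5 n n≥1 π w slope =
    last-minimal⇒primitive n≥1
  , (λ π[n]≢1 → neighbour⇒almost-primitive (ℓ-neighbour n≥1 π[n]≢1))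
  , (λ π[n]≢n → neighbour⇒almost-primitive (r-neighbour n≥1 π[n]≢n))
  , collapse-criterion π n≥1
  where
  open Positions π
  open SlopeWord π w slope
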